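{- Partisan scoring positional games belong to Milnor's universe, i.e. they are dicotic and nonzugzwang: for every hypergraph $H=(V,E)$ whose hyperedges are colored blue, red or green, and every pair of disjoint sets $V_L,V_R\subseteq V$, (i) Left has an available move in the position $(H,V_L,V_R)$ if and only if Right has one, and (ii) $Ls(H,V_L,V_R)\geq Rs(H,V_L,V_R)$.
   Context: A partisan scoring positional game is played on a finite hypergraph $H=(V,E)$ whose hyperedges are each colored blue, red or green. Two players, Left and Right, alternately claim a not yet claimed vertex until all vertices are claimed. At the end, Left's score is the number of blue or green hyperedges all of whose vertices she claimed, Right's score is the number of red or green hyperedges all of whose vertices he claimed, and the final value is Left's score minus Right's score; Left maximizes and Right minimizes it. A position is $(H,V_L,V_R)$ with $V_L,V_R$ disjoint sets of vertices already claimed by Left and Right; $V_F=V\setminus (V_L\cup V_R)$ and a move consists in claiming a vertex of $V_F$. Recursively, if $V_F\neq\emptyset$, $Ls(P)=\max_{x\in V_F}Rs(H,V_L\cup\{x\},V_R)$ and $Rs(P)=\min_{x\in V_F}Ls(H,V_L,V_R\cup\{x\})$; if $V_F=\emptyset$ both equal the final value. -}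

module Defs where

open import Data.Nat as ℕ using (ℕ; zero; suc)
open import Data.Integer as ℤ using (ℤ; _-_; _⊔_; _⊓_; +_)
open import Data.Fin using (Fin)
open import Data.Fin.Subset using (Subset; _∈_; _∉_; _⊆_; _∪_; ∁; ⁅_⁆; ∣_∣; Nonempty)
open import Data.Fin.Subset.Properties using (_∈?_; _⊆?_)
open import Data.List using (List; []; _∷_; filter; map; foldr; allFin)
open import Data.Product using (_×_; _,_; ∃-syntax)
open import Relation.Nullary using (does)
open import Data.Bool using (Bool; true; false; if_then_else_)

data Colour : Set where
  blue red green : Colour

-- A hypergraph with vertex set Fin n; the hyperedges form a finite list of
-- coloured vertex subsets (a list, so repeated hyperedges are allowed).
record Hypergraph (n : ℕ) : Set where
  constructor hypergraph
  field
    edges : List (Colour × Subset n)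
open Hypergraph public

countsForLeft : Colour → Bool
countsForLeft blue  = true
countsForLeft red   = false
countsForLeft green = true

countsForRight : Colour → Bool
countsForRight blue  = false
countsForRight red   = true
countsForRight green = true

score : ∀ {n} → (Colour → Bool) → List (Colour × Subset n) → Subset n → ℕ
score ok [] S = 0
score ok ((c , e) ∷ es) S =
  (if ok c ∧ does (e ⊆? S) then 1 else 0) ℕ.+ score ok es S
  where
  _∧_ : Bool → Bool → Bool
  true ∧ b = b
  false ∧ _ = false

finalValue : ∀ {n} → Hypergraph n → Subset n → Subset n → ℤ
finalValue H VL VR =
  + score countsForLeft (edges H) VL - + score countsForRight (edges H) VR

freeSet : ∀ {n} → Subset n → Subset n → Subset n
freeSet VL VR = ∁ (VL ∪ VR)

freeList : ∀ {n} → Subset n → Subset n → List (Fin n)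
freeList VL VR = filter (_∈? freeSet VL VR) (allFin _)

maxOver minOver : ∀ {n} → List (Fin n) → (Fin n → ℤ) → ℤ → ℤ
maxOver []       f d = d
maxOver (x ∷ xs) f d = foldr _⊔_ (f x) (map f xs)
minOver []       f d = d
minOver (x ∷ xs) f d = foldr _⊓_ (f x) (map f xs)

-- Game values with fuel k; the fuel is instantiated with |V_F|, which
-- decreases by exactly one at every move, so fuel never runs out early.
-- If V_F is empty, both return the final value.
LsF RsF : ℕ → ∀ {n} → Hypergraph n → Subset n → Subset n → ℤ
LsF zero    H VL VR = finalValue H VL VR
LsF (suc k) H VL VR =
  maxOver (freeList VL VR) (λ x → RsF k H (VL ∪ ⁅ x ⁆) VR) (finalValue H VL VR)
RsF zero    H VL VR = finalValue H VL VR
RsF (suc k) H VL VR =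
  minOver (freeList VL VR) (λ x → LsF k H VL (VR ∪ ⁅ x ⁆)) (finalValue H VL VR)

Ls Rs : ∀ {n} → Hypergraph n → Subset n → Subset n → ℤ
Ls H VL VR = LsF ∣ freeSet VL VR ∣ H VL VR
Rs H VL VR = RsF ∣ freeSet VL VR ∣ H VL VR

Disjoint : ∀ {n} → Subset n → Subset n → Set
Disjoint {n} VL VR = ∀ (x : Fin n) → x ∈ VL → x ∉ VR

LeftHasMove RightHasMove : ∀ {n} → Hypergraph n → Subset n → Subset n → Set
LeftHasMove  {n} H VL VR = ∃[ x ] (x ∈ freeSet VL VR)
RightHasMove {n} H VL VR = ∃[ x ] (x ∈ freeSet VL VR)

-- Part (i) holds because both players choose among the same free vertices.
-- For (ii), the point is that an extra vertex never hurts its owner: scores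
-- are monotone in the claimed sets. By simultaneous induction on the number
-- of free vertices one shows, for every free vertex x,
--   Rs(P) ≤ Ls(P),   Rs(P) ≤ Rs(P + Left x),   Ls(P) ≤ Ls(P + Left x),
-- where in the last one Left moves again after receiving x. The first follows
-- from the second by Left playing x. The second holds since every answer y of
-- Right is met by the third at P + Right y. The third is the first when Left's
-- move is x; when Left's move is y ≠ x it is the second at P + Left y,
-- followed by interchanging the order in which Left took x and y.
module Submission where

open import Defs
open import Data.Nat using (ℕ)
open import Data.Integer using (_≥_)
open import Data.Fin.Subset using (Subset)
open import Data.Product using (_×_)
open import Function.Bundles using (_⇔_)

open import Data.Nat as ℕ using (zero; suc)
import Data.Nat.Properties as ℕ
open import Data.Integer as ℤ using (ℤ; _≤_; +_; +≤+)
open import Data.Integer.Properties as ℤ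
  using (≤-refl; ≤-trans; i≤j⇒i≤j⊔k; i≤j⇒i≤k⊔j; i≤j⇒i⊓k≤j; i≤j⇒k⊓i≤j; ⊔-lub; ⊓-glb)
open import Data.Fin using (Fin; _≟_)
open import Data.Fin.Subset
  using (_∈_; _∉_; _⊆_; _∪_; _─_; _-_; ∁; ⁅_⁆; ∣_∣; inside; outside; Nonempty)
open import Data.Fin.Subset.Properties
  using ( _∈?_; _⊆?_; nonempty?; Empty-unique; ∣⊥∣≡0; p─⊥≡p; p─q⊆p
        ; x∈p∧x≢y⇒x∈p-y; x∉⁅y⁆⇒x≢y; p⊆p∪q; ⊆-trans; ∪-assoc; ∪-commutativeMonoid)
open import Data.Vec using ([]; _∷_; here; there)
open import Data.List using (List; []; _∷_; map; allFin)
open import Data.List.Membership.Propositional using () renaming (_∈_ to _∈ₗ_)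
open import Data.List.Membership.Propositional.Properties using (∈-filter⁺; ∈-filter⁻; ∈-allFin; ∈-map⁺)
open import Data.List.Properties using (foldr-preservesᵒ; foldr-preservesᵇ)
open import Data.List.Relation.Unary.Any as Any using (Any)
import Data.List.Relation.Unary.All as All
import Data.List.Relation.Unary.All.Properties as All
open import Data.Product using (_,_; proj₂)
open import Data.Sum using (_⊎_; inj₁; inj₂; [_,_])
open import Data.Bool using (true; false)
open import Data.Empty using (⊥-elim)
open import Relation.Nullary using (yes; no; contradiction)
open import Relation.Binary.PropositionalEquality
  using (_≡_; _≢_; refl; sym; trans; cong)
open import Function.Base using (_∘_; id)
open import Function.Bundles using (mk⇔)
open import Algebra.Bundles using (CommutativeMonoid)
import Algebra.Properties.CommutativeSemigroup

module _ {n : ℕ} (f : Fin n → ℤ) where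

  maxOver-upper : ∀ {xs y} d → y ∈ₗ xs → f y ≤ maxOver xs f d
  maxOver-upper {x ∷ xs} {y} _ y∈xs = foldr-preservesᵒ {P = f y ≤_}
    (λ a b → [ i≤j⇒i≤j⊔k b , i≤j⇒i≤k⊔j a ]) (f x) (map f xs) (split y∈xs)
    where
    split : y ∈ₗ x ∷ xs → f y ≤ f x ⊎ Any (f y ≤_) (map f xs)
    split (Any.here refl)  = inj₁ ≤-refl
    split (Any.there y∈xs) = inj₂ (Any.map ℤ.≤-reflexive (∈-map⁺ f y∈xs))

  maxOver-least : ∀ {xs c y} d → y ∈ₗ xs → (∀ {z} → z ∈ₗ xs → f z ≤ c) → maxOver xs f d ≤ c
  maxOver-least {x ∷ xs} {c} _ _ bound = foldr-preservesᵇ {P = _≤ c}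
    ⊔-lub (bound (Any.here refl)) (All.map⁺ (All.tabulate (bound ∘ Any.there)))

  minOver-lower : ∀ {xs y} d → y ∈ₗ xs → minOver xs f d ≤ f y
  minOver-lower {x ∷ xs} {y} _ y∈xs = foldr-preservesᵒ {P = _≤ f y}
    (λ a b → [ i≤j⇒i⊓k≤j b , i≤j⇒k⊓i≤j a ]) (f x) (map f xs) (split y∈xs)
    where
    split : y ∈ₗ x ∷ xs → f x ≤ f y ⊎ Any (_≤ f y) (map f xs)
    split (Any.here refl)  = inj₁ ≤-refl
    split (Any.there y∈xs) = inj₂ (Any.map (ℤ.≤-reflexive ∘ sym) (∈-map⁺ f y∈xs))

  minOver-greatest : ∀ {xs c y} d → y ∈ₗ xs → (∀ {z} → z ∈ₗ xs → c ≤ f z) → c ≤ minOver xs f d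
  minOver-greatest {x ∷ xs} {c} _ _ bound = foldr-preservesᵇ {P = c ≤_}
    ⊓-glb (bound (Any.here refl)) (All.map⁺ (All.tabulate (bound ∘ Any.there)))

∁[p∪q]≡∁p─q : ∀ {n} (p q : Subset n) → ∁ (p ∪ q) ≡ ∁ p ─ q
∁[p∪q]≡∁p─q []            []            = refl
∁[p∪q]≡∁p─q (inside  ∷ p) (inside  ∷ q) = cong (outside ∷_) (∁[p∪q]≡∁p─q p q)
∁[p∪q]≡∁p─q (inside  ∷ p) (outside ∷ q) = cong (outside ∷_) (∁[p∪q]≡∁p─q p q)
∁[p∪q]≡∁p─q (outside ∷ p) (inside  ∷ q) = cong (outside ∷_) (∁[p∪q]≡∁p─q p q)
∁[p∪q]≡∁p─q (outside ∷ p) (outside ∷ q) = cong (inside ∷_) (∁[p∪q]≡∁p─q p q)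

x∈p─q⇒x∉q : ∀ {n} {p q : Subset n} {x} → x ∈ p ─ q → x ∉ q
x∈p─q⇒x∉q {p = _ ∷ _} {inside ∷ _} () here
x∈p─q⇒x∉q {p = _ ∷ _} {_      ∷ _} (there x∈p─q) (there x∈q) = x∈p─q⇒x∉q x∈p─q x∈q

x∈p⇒suc∣p-x∣≡∣p∣ : ∀ {n} {p : Subset n} {x} → x ∈ p → suc ∣ p - x ∣ ≡ ∣ p ∣
x∈p⇒suc∣p-x∣≡∣p∣ {p = inside  ∷ p} here        = cong (suc ∘ ∣_∣) (p─⊥≡p p)
x∈p⇒suc∣p-x∣≡∣p∣ {p = inside  ∷ _} (there x∈p) = cong suc (x∈p⇒suc∣p-x∣≡∣p∣ x∈p)
x∈p⇒suc∣p-x∣≡∣p∣ {p = outside ∷ _} (there x∈p) = x∈p⇒suc∣p-x∣≡∣p∣ x∈p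

x∈p⇒∣p∣≢0 : ∀ {n} {p : Subset n} {x} → x ∈ p → ∣ p ∣ ≢ 0
x∈p⇒∣p∣≢0 x∈p = ℕ.1+n≢0 ∘ trans (x∈p⇒suc∣p-x∣≡∣p∣ x∈p)

∣p∣≡suc⇒Nonempty : ∀ {n} {p : Subset n} {k} → ∣ p ∣ ≡ suc k → Nonempty p
∣p∣≡suc⇒Nonempty {n} {p} size with nonempty? p
... | yes p≢∅ = p≢∅
... | no  p-empty =
  contradiction (trans (sym size) (trans (cong ∣_∣ (Empty-unique p-empty)) (∣⊥∣≡0 n))) ℕ.1+n≢0

score-mono : ∀ {n} ok (es : List (Colour × Subset n)) {A B} → A ⊆ B → score ok es A ℕ.≤ score ok es B
score-mono ok []             A⊆B = ℕ.z≤n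
score-mono ok ((c , e) ∷ es) {A} {B} A⊆B with ok c
... | false = score-mono ok es A⊆B
... | true with e ⊆? A | e ⊆? B
...   | yes _   | yes _   = ℕ.s≤s (score-mono ok es A⊆B)
...   | yes e⊆A | no  e⊈B = ⊥-elim (e⊈B (⊆-trans e⊆A A⊆B))
...   | no  _   | yes _   = ℕ.m≤n⇒m≤1+n (score-mono ok es A⊆B)
...   | no  _   | no  _   = score-mono ok es A⊆B

finalValue-monoˡ : ∀ {n} (H : Hypergraph n) {VL VL′} VR → VL ⊆ VL′ →
  finalValue H VL VR ≤ finalValue H VL′ VR
finalValue-monoˡ H VR VL⊆VL′ =
  ℤ.+-monoˡ-≤ (ℤ.- + score countsForRight (edges H) VR)
              (+≤+ (score-mono countsForLeft (edges H) VL⊆VL′))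

finalValue-antimonoʳ : ∀ {n} (H : Hypergraph n) VL {VR VR′} → VR ⊆ VR′ →
  finalValue H VL VR′ ≤ finalValue H VL VR
finalValue-antimonoʳ H VL VR⊆VR′ =
  ℤ.+-monoʳ-≤ (+ _) (ℤ.neg-mono-≤ (+≤+ (score-mono countsForRight (edges H) VR⊆VR′)))

module _ {n : ℕ} where

  open Algebra.Properties.CommutativeSemigroup
    (CommutativeMonoid.commutativeSemigroup (∪-commutativeMonoid n)) using (xy∙z≈xz∙y)

  freeSet-claimˡ : ∀ (VL VR : Subset n) x → freeSet (VL ∪ ⁅ x ⁆) VR ≡ freeSet VL VR - x
  freeSet-claimˡ VL VR x = trans (cong ∁ (xy∙z≈xz∙y VL ⁅ x ⁆ VR)) (∁[p∪q]≡∁p─q (VL ∪ VR) ⁅ x ⁆)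

  freeSet-claimʳ : ∀ (VL VR : Subset n) x → freeSet VL (VR ∪ ⁅ x ⁆) ≡ freeSet VL VR - x
  freeSet-claimʳ VL VR x = trans (cong ∁ (sym (∪-assoc VL VR ⁅ x ⁆))) (∁[p∪q]≡∁p─q (VL ∪ VR) ⁅ x ⁆)

  ∪-swap : ∀ (VL : Subset n) x y → (VL ∪ ⁅ x ⁆) ∪ ⁅ y ⁆ ≡ (VL ∪ ⁅ y ⁆) ∪ ⁅ x ⁆
  ∪-swap VL x y = xy∙z≈xz∙y VL ⁅ x ⁆ ⁅ y ⁆

  module _ {VL VR : Subset n} {x y : Fin n} where

    ∈-freeSet-claimˡ⁺ : y ∈ freeSet VL VR → y ≢ x → y ∈ freeSet (VL ∪ ⁅ x ⁆) VR
    ∈-freeSet-claimˡ⁺ rewrite freeSet-claimˡ VL VR x = x∈p∧x≢y⇒x∈p-y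

    ∈-freeSet-claimʳ⁺ : y ∈ freeSet VL VR → y ≢ x → y ∈ freeSet VL (VR ∪ ⁅ x ⁆)
    ∈-freeSet-claimʳ⁺ rewrite freeSet-claimʳ VL VR x = x∈p∧x≢y⇒x∈p-y

    ∈-freeSet-claimˡ⁻ : y ∈ freeSet (VL ∪ ⁅ x ⁆) VR → y ∈ freeSet VL VR × y ≢ x
    ∈-freeSet-claimˡ⁻ rewrite freeSet-claimˡ VL VR x =
      λ y∈F-x → p─q⊆p _ _ y∈F-x , x∉⁅y⁆⇒x≢y (x∈p─q⇒x∉q y∈F-x)

  module _ {VL VR : Subset n} {x : Fin n} {k : ℕ}
           (size : ∣ freeSet VL VR ∣ ≡ suc k) (x-free : x ∈ freeSet VL VR) where

    ∣freeSet-claimˡ∣ : ∣ freeSet (VL ∪ ⁅ x ⁆) VR ∣ ≡ k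
    ∣freeSet-claimˡ∣ rewrite freeSet-claimˡ VL VR x =
      ℕ.suc-injective (trans (x∈p⇒suc∣p-x∣≡∣p∣ x-free) size)

    ∣freeSet-claimʳ∣ : ∣ freeSet VL (VR ∪ ⁅ x ⁆) ∣ ≡ k
    ∣freeSet-claimʳ∣ rewrite freeSet-claimʳ VL VR x =
      ℕ.suc-injective (trans (x∈p⇒suc∣p-x∣≡∣p∣ x-free) size)

  ∈-freeList⁺ : ∀ {VL VR : Subset n} {x} → x ∈ freeSet VL VR → x ∈ₗ freeList VL VR
  ∈-freeList⁺ {VL} {VR} = ∈-filter⁺ (_∈? freeSet VL VR) (∈-allFin _)

  ∈-freeList⁻ : ∀ {VL VR : Subset n} {x} → x ∈ₗ freeList VL VR → x ∈ freeSet VL VR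
  ∈-freeList⁻ {VL} {VR} = proj₂ ∘ ∈-filter⁻ (_∈? freeSet VL VR) {xs = allFin _}

module _ {n : ℕ} (H : Hypergraph n) where

  module _ (k : ℕ) {VL VR : Subset n} where

    RsF-claimˡ≤LsF-suc : ∀ {x} → x ∈ freeSet VL VR → RsF k H (VL ∪ ⁅ x ⁆) VR ≤ LsF (suc k) H VL VR
    RsF-claimˡ≤LsF-suc = maxOver-upper (λ y → RsF k H (VL ∪ ⁅ y ⁆) VR) _ ∘ ∈-freeList⁺

    LsF-suc≤ : ∀ {c} → Nonempty (freeSet VL VR) →
      (∀ {y} → y ∈ freeSet VL VR → RsF k H (VL ∪ ⁅ y ⁆) VR ≤ c) → LsF (suc k) H VL VR ≤ c
    LsF-suc≤ (x , x-free) bound =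
      maxOver-least (λ y → RsF k H (VL ∪ ⁅ y ⁆) VR) _ (∈-freeList⁺ x-free) (bound ∘ ∈-freeList⁻)

    RsF-suc≤LsF-claimʳ : ∀ {x} → x ∈ freeSet VL VR → RsF (suc k) H VL VR ≤ LsF k H VL (VR ∪ ⁅ x ⁆)
    RsF-suc≤LsF-claimʳ = minOver-lower (λ y → LsF k H VL (VR ∪ ⁅ y ⁆)) _ ∘ ∈-freeList⁺

    ≤RsF-suc : ∀ {c} → Nonempty (freeSet VL VR) →
      (∀ {y} → y ∈ freeSet VL VR → c ≤ LsF k H VL (VR ∪ ⁅ y ⁆)) → c ≤ RsF (suc k) H VL VR
    ≤RsF-suc (x , x-free) bound =
      minOver-greatest (λ y → LsF k H VL (VR ∪ ⁅ y ⁆)) _ (∈-freeList⁺ x-free) (bound ∘ ∈-freeList⁻)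

  mutual

    RsF≤LsF : ∀ k {VL VR} → ∣ freeSet VL VR ∣ ≡ k → RsF k H VL VR ≤ LsF k H VL VR
    RsF≤LsF zero    _    = ≤-refl
    RsF≤LsF (suc k) size with ∣p∣≡suc⇒Nonempty size
    ... | x , x-free = ≤-trans (RsF-suc≤RsF-claimˡ k size x-free) (RsF-claimˡ≤LsF-suc k x-free)

    RsF-suc≤RsF-claimˡ : ∀ k {VL VR x} → ∣ freeSet VL VR ∣ ≡ suc k → x ∈ freeSet VL VR →
      RsF (suc k) H VL VR ≤ RsF k H (VL ∪ ⁅ x ⁆) VR
    RsF-suc≤RsF-claimˡ zero {VL} {VR} {x} _ x-free = begin
      RsF 1 H VL VR                   ≤⟨ RsF-suc≤LsF-claimʳ 0 x-free ⟩
      finalValue H VL (VR ∪ ⁅ x ⁆)    ≤⟨ finalValue-antimonoʳ H VL (p⊆p∪q ⁅ x ⁆) ⟩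
      finalValue H VL VR              ≤⟨ finalValue-monoˡ H VR (p⊆p∪q ⁅ x ⁆) ⟩
      finalValue H (VL ∪ ⁅ x ⁆) VR    ∎
      where open ℤ.≤-Reasoning
    RsF-suc≤RsF-claimˡ (suc k) {VL} {VR} {x} size x-free =
      ≤RsF-suc k (∣p∣≡suc⇒Nonempty (∣freeSet-claimˡ∣ size x-free)) answer
      where
      answer : ∀ {y} → y ∈ freeSet (VL ∪ ⁅ x ⁆) VR →
        RsF (suc (suc k)) H VL VR ≤ LsF k H (VL ∪ ⁅ x ⁆) (VR ∪ ⁅ y ⁆)
      answer y-free′ with ∈-freeSet-claimˡ⁻ y-free′
      ... | y-free , y≢x = ≤-trans (RsF-suc≤LsF-claimʳ (suc k) y-free)
        (LsF-suc≤LsF-claimˡ k (∣freeSet-claimʳ∣ size y-free) (∈-freeSet-claimʳ⁺ x-free (y≢x ∘ sym)))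

    LsF-suc≤LsF-claimˡ : ∀ k {VL VR x} → ∣ freeSet VL VR ∣ ≡ suc k → x ∈ freeSet VL VR →
      LsF (suc k) H VL VR ≤ LsF k H (VL ∪ ⁅ x ⁆) VR
    LsF-suc≤LsF-claimˡ k {VL} {VR} {x} size x-free = LsF-suc≤ k (x , x-free) (move k size)
      where
      move : ∀ j → ∣ freeSet VL VR ∣ ≡ suc j → ∀ {y} → y ∈ freeSet VL VR →
        RsF j H (VL ∪ ⁅ y ⁆) VR ≤ LsF j H (VL ∪ ⁅ x ⁆) VR
      move j size′ {y} y-free with y ≟ x
      ... | yes refl = RsF≤LsF j (∣freeSet-claimˡ∣ size′ x-free)
      move zero size′ y-free | no y≢x =
        contradiction (∣freeSet-claimˡ∣ size′ x-free) (x∈p⇒∣p∣≢0 (∈-freeSet-claimˡ⁺ y-free y≢x))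
      move (suc j) size′ {y} y-free | no y≢x = begin
        RsF (suc j) H (VL ∪ ⁅ y ⁆) VR      ≤⟨ RsF-suc≤RsF-claimˡ j (∣freeSet-claimˡ∣ size′ y-free)
                                                 (∈-freeSet-claimˡ⁺ x-free (y≢x ∘ sym)) ⟩
        RsF j H ((VL ∪ ⁅ y ⁆) ∪ ⁅ x ⁆) VR  ≡⟨ cong (λ VL′ → RsF j H VL′ VR) (∪-swap VL y x) ⟩
        RsF j H ((VL ∪ ⁅ x ⁆) ∪ ⁅ y ⁆) VR  ≤⟨ RsF-claimˡ≤LsF-suc j (∈-freeSet-claimˡ⁺ y-free y≢x) ⟩
        LsF (suc j) H (VL ∪ ⁅ x ⁆) VR      ∎
        where open ℤ.≤-Reasoning

mainTheorem5 : ∀ (n : ℕ) (H : Hypergraph n) (VL VR : Subset n) →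
    Disjoint VL VR →
    (LeftHasMove H VL VR ⇔ RightHasMove H VL VR) × (Ls H VL VR ≥ Rs H VL VR)
mainTheorem5 n H VL VR _ = mk⇔ id id , RsF≤LsF H _ {VL} {VR} refl
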